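{- Let $a,b,c$ be globally coprime positive integers with $1\leq a\leq b$, and set $$r=a+b-(a,c)-(b,c)+1,\quad t=c-(a,c)-(b,c)+1,\quad n=\max(r,t)=\max(a+b,c)-(a,c)-(b,c)+1,$$ where $(x,y)$ denotes the gcd. Then: \begin{enumerate} \item If $a+b=c$, then $(a,b)=(a,c)=(b,c)=1$ and $n=c-1=a+b-1$. \item $n\geq 1$, and the triples with $n=1$ are exactly $(1,1,2)$ and the triples $(1,c,c)$ with $c\geq 1$. \item The triples with $a+b-c\equiv 0\pmod 2$ and $n=2$ are $(1,2,1)$, $(1,2,3)$, and the triples $(2,c,c)$ with $c>2$ odd. \item The triples with $|r-t|=|a+b-c|\neq 0$, $a+b-c\equiv 0\pmod 2$ and $n=4$ are $(1,2,5),(1,4,1),(1,4,3),(1,6,3),(2,3,1),(3,4,3)$, and the triples $(4,c,c)$ with $c>4$ odd. \item The triples with $|r-t|=|a+b-c|=6$ and $n=8$ are $(1,2,9),(1,8,3),(2,7,3),(4,5,3)$. \item The triples with $|r-t|=|a+b-c|=6$ and $n=9$ are $(1,3,10),(1,9,4),(3,7,4),(5,5,4)$. \item For every integer $n_0\geq 1$, the set of triples with $n=n_0$ is the union of a finite set (depending on $n_0$) and the set of triples $(n_0,c,c)$ with $c>n_0$ coprime to $n_0$. \end{enumerate} -}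

module Defs where

open import Data.Nat using (ℕ; _+_; _≤_)
open import Data.Nat.GCD using (gcd)
open import Data.Integer using (ℤ; +_; _-_; _⊔_)
open import Data.Product using (_×_)
open import Relation.Binary.PropositionalEquality using (_≡_)

Admissible : ℕ → ℕ → ℕ → Set
Admissible a b c = 1 ≤ a × a ≤ b × 1 ≤ c × gcd (gcd a b) c ≡ 1

r : ℕ → ℕ → ℕ → ℤ
r a b c = + (a + b) - + gcd a c - + gcd b c Data.Integer.+ + 1

t : ℕ → ℕ → ℕ → ℤ
t a b c = + c - + gcd a c - + gcd b c Data.Integer.+ + 1

nn : ℕ → ℕ → ℕ → ℤ
nn a b c = r a b c ⊔ t a b c

δ : ℕ → ℕ → ℕ → ℤ
δ a b c = + (a + b) - + c

-- Write g = (a,c) and h = (b,c). By definition n + g + h = max(a+b, c) + 1.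
-- If b = c then g = 1 by global coprimality, so a = n: this is the infinite family (n, c, c).
-- Otherwise either h is a proper divisor of b, so h ≤ b/2, or b is a proper divisor of c,
-- and then either g ≤ a/2 or a, b both divide c with (a, b) = 1, so ab ∣ c.  In each case
-- the relation above forces b < 2n + 2 and c < 4n + 2, so every triple with a given n
-- outside the family lies in a finite box, and (2)–(7) follow by searching it.

module Submission where

open import Defs
open import Data.Nat
  using (ℕ; suc; _+_; _*_; _≤_; _<_; _%_; _⊔_; _∸_; _≤?_; _<?_; _≟_; z≤n; s≤s; >-nonZero)
open import Data.Nat.Properties
  using ( ≤-trans; ≤-reflexive; ≤-total; +-suc; +-comm; *-comm; *-identityˡ; +-cancelʳ-≡; +-cancelʳ-≤
        ; +-monoʳ-≤; +-mono-≤; +-mono-<; m≤m+n; m≤n+m; m≤m⊔n; m≤n⊔m; m≤n⇒m⊔n≡n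
        ; m≥n⇒m⊔n≡m; m≤n⇒m<n∨m≡n; n≤1+n; m∸n+n≡m; m<n⇒0<n∸m; <⇒≱; ≮⇒≥; >⇒≢; module ≤-Reasoning )
open import Data.Nat.Tactic.RingSolver using (solve)
open import Data.Nat.DivMod using (m%n<n)
open import Data.Nat.GCD using (gcd; gcd[m,n]∣m; gcd[m,n]∣n; gcd[m,n]≤n; gcd-greatest; gcd-comm; gcd-zeroˡ)
open import Data.Integer using (ℤ; +_; _-_; ∣_∣)
import Data.Integer as ℤ
import Data.Integer.Properties as ℤₚ
open import Data.Integer.Tactic.RingSolver using (solve-∀)
open import Algebra.Properties.AbelianGroup ℤₚ.+-0-abelianGroup using (∙-cancelʳ)
open import Data.Product using (_×_; _,_; ∃-syntax; proj₁; proj₂)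
open import Data.Product.Properties using (≡-dec)
open import Data.Sum using (_⊎_; inj₁; inj₂)
import Data.Sum as Sum
open import Data.List using (List; _∷_; []; upTo; cartesianProduct; filter)
open import Data.List.Membership.Propositional using (_∈_)
open import Data.List.Membership.Propositional.Properties
  using (∈-upTo⁺; ∈-cartesianProduct⁺; ∈-filter⁺; ∈-filter⁻)
import Data.List.Relation.Unary.All as All
open import Function.Base using (id; _∘_)
open import Function.Bundles using (_⇔_; mk⇔; Equivalence)
open import Relation.Nullary using (Dec; yes; no; ¬?; contradiction)
open import Relation.Nullary.Decidable using (_×-dec_; _⊎-dec_; _→-dec_; True; toWitness; from-yes)
open import Relation.Binary.PropositionalEquality
  using (_≡_; _≢_; refl; sym; trans; cong; cong₂; subst; module ≡-Reasoning)

shift : ℕ → ℕ → ℤ → ℤ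
shift g h x = x - + g - + h ℤ.+ + 1

shift-mono-≤ : ∀ g h {x y} → x ℤ.≤ y → shift g h x ℤ.≤ shift g h y
shift-mono-≤ g h x≤y = ℤₚ.+-monoˡ-≤ (+ 1) (ℤₚ.+-monoˡ-≤ (ℤ.- + h) (ℤₚ.+-monoˡ-≤ (ℤ.- + g) x≤y))

x-g-h+1+[g+h]≡1+x : ∀ x g h → x - g - h ℤ.+ + 1 ℤ.+ (g ℤ.+ h) ≡ + 1 ℤ.+ x
x-g-h+1+[g+h]≡1+x = solve-∀

pos-⊔ : ∀ m n → + (m ⊔ n) ≡ + m ℤ.⊔ + n
pos-⊔ m n with ≤-total m n
... | inj₁ m≤n = trans (cong +_ (m≤n⇒m⊔n≡n m≤n)) (sym (ℤₚ.i≤j⇒i⊔j≡j (ℤ.+≤+ m≤n)))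
... | inj₂ n≤m = trans (cong +_ (m≥n⇒m⊔n≡m n≤m)) (sym (ℤₚ.i≥j⇒i⊔j≡i (ℤ.+≤+ n≤m)))

nn≡shift-max : ∀ a b c → nn a b c ≡ shift (gcd a c) (gcd b c) (+ ((a + b) ⊔ c))
nn≡shift-max a b c = begin
  shift g h (+ (a + b)) ℤ.⊔ shift g h (+ c)  ≡⟨ ℤₚ.mono-≤-distrib-⊔ (shift-mono-≤ g h) (+ (a + b)) (+ c) ⟨
  shift g h (+ (a + b) ℤ.⊔ + c)              ≡⟨ cong (shift g h) (pos-⊔ (a + b) c) ⟨
  shift g h (+ ((a + b) ⊔ c))                ∎
  where
  open ≡-Reasoning
  g = gcd a c
  h = gcd b c

nn+gcds≡1+max : ∀ a b c → nn a b c ℤ.+ + (gcd a c + gcd b c) ≡ + suc ((a + b) ⊔ c)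
nn+gcds≡1+max a b c = begin
  nn a b c ℤ.+ + (g + h)               ≡⟨ cong₂ ℤ._+_ (nn≡shift-max a b c) (ℤₚ.pos-+ g h) ⟩
  shift g h (+ m) ℤ.+ (+ g ℤ.+ + h)    ≡⟨ x-g-h+1+[g+h]≡1+x (+ m) (+ g) (+ h) ⟩
  + 1 ℤ.+ + m                          ≡⟨ ℤₚ.pos-+ 1 m ⟨
  + suc m                              ∎
  where
  open ≡-Reasoning
  g = gcd a c
  h = gcd b c
  m = (a + b) ⊔ c

nn≡+⇔ : ∀ a b c n → nn a b c ≡ + n ⇔ suc ((a + b) ⊔ c) ≡ n + (gcd a c + gcd b c)
nn≡+⇔ a b c n = mk⇔
  (λ nn≡n → ℤₚ.+-injective (begin
    + suc ((a + b) ⊔ c)        ≡⟨ nn+gcds≡1+max a b c ⟨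
    nn a b c ℤ.+ + (g + h)     ≡⟨ cong (ℤ._+ + (g + h)) nn≡n ⟩
    + n ℤ.+ + (g + h)          ≡⟨ ℤₚ.pos-+ n (g + h) ⟨
    + (n + (g + h))            ∎))
  (λ E → ∙-cancelʳ (+ (g + h)) (nn a b c) (+ n) (begin
    nn a b c ℤ.+ + (g + h)     ≡⟨ nn+gcds≡1+max a b c ⟩
    + suc ((a + b) ⊔ c)        ≡⟨ cong +_ E ⟩
    + (n + (g + h))            ≡⟨ ℤₚ.pos-+ n (g + h) ⟩
    + n ℤ.+ + (g + h)          ∎))
  where
  open ≡-Reasoning
  g = gcd a c
  h = gcd b c

-- L ≤ R is a sum of hypotheses; the identity, checked by the ring solver, shows that it entails x ≤ y.
≤-by-linear-combination : ∀ {x y L R} s → L ≤ R → x + R + s ≡ y + L → x ≤ y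
≤-by-linear-combination {x} {y} {L} {R} s L≤R x+R+s≡y+L = +-cancelʳ-≤ R x y (begin
  x + R      ≤⟨ m≤m+n (x + R) s ⟩
  x + R + s  ≡⟨ x+R+s≡y+L ⟩
  y + L      ≤⟨ +-monoʳ-≤ y L≤R ⟩
  y + R      ∎)
  where open ≤-Reasoning

m+m≤n+n⇒m≤n : ∀ {m n} → m + m ≤ n + n → m ≤ n
m+m≤n+n⇒m≤n m+m≤n+n = ≮⇒≥ (λ n<m → <⇒≱ (+-mono-< n<m n<m) m+m≤n+n)

m+m≤[2+k]*m : ∀ k m → m + m ≤ (2 + k) * m
m+m≤[2+k]*m k m = +-monoʳ-≤ m (m≤m+n m (k * m))

Bounded : ℕ → ℕ → ℕ → Set
Bounded n b c = b < 2 * n + 2 × c < 4 * n + 2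

bounded-if-2h≤b : ∀ {n a b c g h} → g ≤ a → a ≤ b → h + h ≤ b →
                  (a + b) ⊔ c < n + (g + h) → Bounded n b c
bounded-if-2h≤b {n} {a} {b} {c} {g} {h} g≤a a≤b 2h≤b max<n+g+h =
  ≤-by-linear-combination 3 b+2≤2n (solve (n ∷ b ∷ [])) ,
  m+m≤n+n⇒m≤n (≤-by-linear-combination 10
    (+-mono-≤ (+-mono-≤ (+-mono-≤ c<n+g+h c<n+g+h) (+-mono-≤ g≤b g≤b))
              (+-mono-≤ 2h≤b (+-mono-≤ b+2≤2n (+-mono-≤ b+2≤2n b+2≤2n))))
    (solve (n ∷ b ∷ c ∷ g ∷ h ∷ [])))
  where
  g≤b = ≤-trans g≤a a≤b
  a+b<n+g+h = ≤-trans (s≤s (m≤m⊔n (a + b) c)) max<n+g+h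
  c<n+g+h = ≤-trans (s≤s (m≤n⊔m (a + b) c)) max<n+g+h
  b+2≤2n : b + 2 ≤ n + n
  b+2≤2n = ≤-by-linear-combination 0
    (+-mono-≤ (+-mono-≤ (+-mono-≤ a+b<n+g+h a+b<n+g+h) (+-mono-≤ g≤a g≤a)) 2h≤b)
    (solve (n ∷ a ∷ b ∷ g ∷ h ∷ []))

bounded-if-2g≤a : ∀ {n a b c g} → a ≤ b → g + g ≤ a → b + b ≤ c → c < n + (g + b) → Bounded n b c
bounded-if-2g≤a {n} {a} {b} {c} {g} a≤b 2g≤a 2b≤c c<n+g+b =
  ≤-by-linear-combination 3 b+2≤2n (solve (n ∷ b ∷ [])) ,
  ≤-by-linear-combination 5
    (+-mono-≤ (+-mono-≤ (+-mono-≤ c<n+g+b c<n+g+b) (+-mono-≤ 2b≤c 2g≤a)) (+-mono-≤ a≤b b+2≤2n))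
    (solve (n ∷ a ∷ b ∷ c ∷ g ∷ []))
  where
  b+2≤2n : b + 2 ≤ n + n
  b+2≤2n = ≤-by-linear-combination 0
    (+-mono-≤ (+-mono-≤ (+-mono-≤ 2b≤c 2b≤c) (+-mono-≤ c<n+g+b c<n+g+b)) (+-mono-≤ 2g≤a a≤b))
    (solve (n ∷ a ∷ b ∷ c ∷ g ∷ []))

bounded-if-c≡[2+k]*b : ∀ {n a b c k} → a ≤ b → a ≤ 2 + k → 0 < b → c ≡ (2 + k) * b →
                       c < n + (a + b) → Bounded n b c
bounded-if-c≡[2+k]*b {n} {a} {suc b} {k = k} a≤b a≤2+k _ refl c<n+a+b =
  ≤-by-linear-combination n b≤n+1 (solve (n ∷ b ∷ [])) ,
  ≤-by-linear-combination n (+-mono-≤ (+-mono-≤ c<n+a+b a≤b) (+-mono-≤ b≤n+1 b≤n+1))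
    (solve (n ∷ a ∷ b ∷ k ∷ []))
  where
  b≤n+1 : suc b ≤ n + 1
  b≤n+1 = ≤-by-linear-combination (k * b) (+-mono-≤ c<n+a+b a≤2+k) (solve (n ∷ a ∷ b ∷ k ∷ []))

Family : ℕ → ℕ → ℕ → ℕ → Set
Family n a b c = a ≡ n × b ≡ c × n < c × gcd n c ≡ 1

module _ where
  open import Data.Nat.Divisibility
    using (_∣_; divides; ∣-refl; ∣-trans; ∣-antisym; ∣⇒≤; ∣1⇒≡1; ∣m∣n⇒∣m+n; ∣m+n∣m⇒∣n; m%n≡0⇒n∣m)
  open import Data.Nat.Coprimality using (Coprime; coprime-divisor)

  ∣∧≢⇒≡[2+k]*m : ∀ {m n} → 0 < n → m ∣ n → m ≢ n → ∃[ k ] n ≡ (2 + k) * m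
  ∣∧≢⇒≡[2+k]*m 0<n (divides 0 n≡0) _ = contradiction n≡0 (>⇒≢ 0<n)
  ∣∧≢⇒≡[2+k]*m {m} _ (divides 1 n≡1*m) m≢n = contradiction (sym (trans n≡1*m (*-identityˡ m))) m≢n
  ∣∧≢⇒≡[2+k]*m _ (divides (suc (suc k)) n≡[2+k]*m) _ = k , n≡[2+k]*m

  ∣∧≢⇒m+m≤n : ∀ {m n} → 0 < n → m ∣ n → m ≢ n → m + m ≤ n
  ∣∧≢⇒m+m≤n {m} 0<n m∣n m≢n with k , refl ← ∣∧≢⇒≡[2+k]*m 0<n m∣n m≢n = m+m≤[2+k]*m k m

  gcd[n,n]≡n : ∀ n → gcd n n ≡ n
  gcd[n,n]≡n n = ∣-antisym (gcd[m,n]∣m n n) (gcd-greatest ∣-refl ∣-refl)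

  gcd[m,n]≤m : ∀ {m} n → 0 < m → gcd m n ≤ m
  gcd[m,n]≤m {m} n 0<m = subst (_≤ m) (gcd-comm n m) (gcd[m,n]≤n n m {{>-nonZero 0<m}})

  common-divisor≡1 : ∀ {a b c d} → Admissible a b c → d ∣ a → d ∣ b → d ∣ c → d ≡ 1
  common-divisor≡1 {d = d} (_ , _ , _ , gcd≡1) d∣a d∣b d∣c =
    ∣1⇒≡1 (subst (d ∣_) gcd≡1 (gcd-greatest (gcd-greatest d∣a d∣b) d∣c))

  coprime-if-b≡c : ∀ {a b} → Admissible a b b → gcd a b ≡ 1
  coprime-if-b≡c {a} {b} adm = common-divisor≡1 adm (gcd[m,n]∣m a b) (gcd[m,n]∣n a b) (gcd[m,n]∣n a b)

  pairwise-coprime-if-a+b≡c : ∀ {a b c} → Admissible a b c → a + b ≡ c →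
                              gcd a b ≡ 1 × gcd a c ≡ 1 × gcd b c ≡ 1
  pairwise-coprime-if-a+b≡c {a} {b} adm refl =
    common-divisor≡1 adm (gcd[m,n]∣m a b) (gcd[m,n]∣n a b) (∣m∣n⇒∣m+n (gcd[m,n]∣m a b) (gcd[m,n]∣n a b)) ,
    common-divisor≡1 adm (gcd[m,n]∣m a c) (∣m+n∣m⇒∣n (gcd[m,n]∣n a c) (gcd[m,n]∣m a c)) (gcd[m,n]∣n a c) ,
    common-divisor≡1 adm (∣m+n∣m⇒∣n (subst (gcd b c ∣_) (+-comm a b) (gcd[m,n]∣n b c)) (gcd[m,n]∣m b c))
                         (gcd[m,n]∣m b c) (gcd[m,n]∣n b c)
    where c = a + b

  gcd[2k,n]≡1⇒n%2≡1 : ∀ k n → gcd (2 * k) n ≡ 1 → n % 2 ≡ 1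
  gcd[2k,n]≡1⇒n%2≡1 k n gcd≡1 with n % 2 | m%n<n n 2 | m%n≡0⇒n∣m n 2
  ... | 0 | _ | 2∣n =
    contradiction (∣1⇒≡1 (subst (2 ∣_) gcd≡1 (gcd-greatest (divides k (*-comm 2 k)) (2∣n refl)))) λ ()
  ... | 1 | _ | _ = refl
  ... | suc (suc _) | s≤s (s≤s ()) | _

  a≡n-if-b≡c : ∀ {n a b} → Admissible a b b → suc ((a + b) ⊔ b) ≡ n + (gcd a b + gcd b b) → a ≡ n
  a≡n-if-b≡c {n} {a} {b} adm E = +-cancelʳ-≡ (suc b) a n (begin
    a + suc b                ≡⟨ +-suc a b ⟩
    suc (a + b)              ≡⟨ cong suc (m≥n⇒m⊔n≡m (m≤n+m b a)) ⟨
    suc ((a + b) ⊔ b)        ≡⟨ E ⟩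
    n + (gcd a b + gcd b b)  ≡⟨ cong₂ (λ g h → n + (g + h)) (coprime-if-b≡c adm) (gcd[n,n]≡n b) ⟩
    n + suc b                ∎)
    where open ≡-Reasoning

  family⊎bounded-if-b≡c : ∀ {n a b} → Admissible a b b → suc ((a + b) ⊔ b) ≡ n + (gcd a b + gcd b b) →
                          Family n a b b ⊎ Bounded n b b
  family⊎bounded-if-b≡c {n} {a} adm@(_ , a≤b , _) E with refl ← a≡n-if-b≡c {n} adm E | m≤n⇒m<n∨m≡n a≤b
  ... | inj₁ a<b = inj₁ (refl , refl , a<b , coprime-if-b≡c adm)
  ... | inj₂ refl = inj₂ (≤-by-linear-combination (a + 1) (z≤n {0}) (solve (a ∷ [])) ,
                          ≤-by-linear-combination (3 * a + 1) (z≤n {0}) (solve (a ∷ [])))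

  bounded-if-b∣c : ∀ {n a b c} → Admissible a b c → b ≢ c → b ∣ c → c < n + (gcd a c + b) →
                   Bounded n b c
  bounded-if-b∣c {n} {a} {b} adm@(1≤a , a≤b , 1≤c , _) b≢c b∣c c<n+g+b
    with k , refl ← ∣∧≢⇒≡[2+k]*m 1≤c b∣c b≢c
    with gcd a ((2 + k) * b) ≟ a
  ... | no g≢a =
    bounded-if-2g≤a {n} a≤b (∣∧≢⇒m+m≤n 1≤a (gcd[m,n]∣m a ((2 + k) * b)) g≢a) (m+m≤[2+k]*m k b) c<n+g+b
  ... | yes g≡a =
    bounded-if-c≡[2+k]*b {n} a≤b a≤2+k (≤-trans 1≤a a≤b) refl (subst (λ g → _ < n + (g + b)) g≡a c<n+g+b)
    where
    coprime : Coprime a b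
    coprime (d∣a , d∣b) = common-divisor≡1 adm d∣a d∣b (∣-trans d∣b b∣c)
    a∣[2+k]*b : a ∣ (2 + k) * b
    a∣[2+k]*b = subst (_∣ (2 + k) * b) g≡a (gcd[m,n]∣n a ((2 + k) * b))
    a≤2+k : a ≤ 2 + k
    a≤2+k = ∣⇒≤ (coprime-divisor coprime (subst (a ∣_) (*-comm (2 + k) b) a∣[2+k]*b))

  family⊎bounded : ∀ {n a b c} → Admissible a b c → suc ((a + b) ⊔ c) ≡ n + (gcd a c + gcd b c) →
                   Family n a b c ⊎ Bounded n b c
  -- Splitting on b ≟ c instead would also rewrite the comparison of b with c hidden inside gcd b c.
  family⊎bounded {n} {a} {b} {c} adm@(1≤a , a≤b , _) E with c ≟ b
  ... | yes refl = family⊎bounded-if-b≡c adm E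
  ... | no c≢b with gcd b c ≟ b
  ...   | no h≢b = inj₂ (bounded-if-2h≤b {n} (gcd[m,n]≤m c 1≤a) a≤b
          (∣∧≢⇒m+m≤n (≤-trans 1≤a a≤b) (gcd[m,n]∣m b c) h≢b) (≤-reflexive E))
  ...   | yes h≡b = inj₂ (bounded-if-b∣c {n} adm (c≢b ∘ sym) (subst (_∣ c) h≡b (gcd[m,n]∣n b c))
          (subst (λ h → c < n + (gcd a c + h)) h≡b (≤-trans (s≤s (m≤n⊔m (a + b) c)) (≤-reflexive E))))

a+b≡c⇒nn≡c-1 : ∀ {a b c} → Admissible a b c → a + b ≡ c → nn a b c ≡ + c - + 1
a+b≡c⇒nn≡c-1 {a} {b} {suc c′} adm a+b≡c = Equivalence.from (nn≡+⇔ a b (suc c′) c′) (begin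
  suc ((a + b) ⊔ suc c′)      ≡⟨ cong suc (m≤n⇒m⊔n≡n (≤-reflexive a+b≡c)) ⟩
  suc (suc c′)                ≡⟨ +-comm 2 c′ ⟩
  c′ + 2                      ≡⟨ cong₂ (λ g h → c′ + (g + h)) gcd[a,c]≡1 gcd[b,c]≡1 ⟨
  c′ + (gcd a c + gcd b c)    ∎)
  where
  open ≡-Reasoning
  c = suc c′
  gcd[a,c]≡1 = proj₁ (proj₂ (pairwise-coprime-if-a+b≡c adm a+b≡c))
  gcd[b,c]≡1 = proj₂ (proj₂ (pairwise-coprime-if-a+b≡c adm a+b≡c))

1≤nn : ∀ {a b c} → Admissible a b c → ℤ.+ 1 ℤ.≤ nn a b c
1≤nn {a} {b} {c} (1≤a , a≤b , _) =
  subst (+ 1 ℤ.≤_) (sym nn≡1+max∸gcds) (ℤ.+≤+ (m<n⇒0<n∸m (s≤s gcds≤max)))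
  where
  gcds≤max : gcd a c + gcd b c ≤ (a + b) ⊔ c
  gcds≤max = ≤-trans (+-mono-≤ (gcd[m,n]≤m c 1≤a) (gcd[m,n]≤m c (≤-trans 1≤a a≤b))) (m≤m⊔n (a + b) c)
  nn≡1+max∸gcds : nn a b c ≡ + (suc ((a + b) ⊔ c) ∸ (gcd a c + gcd b c))
  nn≡1+max∸gcds = Equivalence.from (nn≡+⇔ a b c _) (sym (m∸n+n≡m (≤-trans gcds≤max (n≤1+n _))))

nn-family : ∀ n c → gcd n c ≡ 1 → nn n c c ≡ + n
nn-family n c gcd[n,c]≡1 = Equivalence.from (nn≡+⇔ n c c n) (begin
  suc ((n + c) ⊔ c)         ≡⟨ cong suc (m≥n⇒m⊔n≡m (m≤n+m c n)) ⟩
  suc (n + c)               ≡⟨ +-suc n c ⟨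
  n + (1 + c)               ≡⟨ cong₂ (λ g h → n + (g + h)) gcd[n,c]≡1 (gcd[n,n]≡n c) ⟨
  n + (gcd n c + gcd c c)   ∎)
  where open ≡-Reasoning

r-t≡δ : ∀ a b c → r a b c - t a b c ≡ δ a b c
r-t≡δ a b c = shift-difference (+ (a + b)) (+ c) (+ gcd a c) (+ gcd b c)
  where
  shift-difference : ∀ x y g h → (x - g - h ℤ.+ + 1) - (y - g - h ℤ.+ + 1) ≡ x - y
  shift-difference = solve-∀

δ-family : ∀ n c → δ n c c ≡ + n
δ-family n c = trans (cong (_- + c) (ℤₚ.pos-+ n c)) (x+y-y≡x (+ n) (+ c))
  where
  x+y-y≡x : ∀ x y → x ℤ.+ y - y ≡ x
  x+y-y≡x = solve-∀

|r-t|-family : ∀ n c → ∣ r n c c - t n c c ∣ ≡ n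
|r-t|-family n c = cong ∣_∣ (trans (r-t≡δ n c c) (δ-family n c))

|r-t|≢m-family : ∀ n c {m} → n ≢ m → ∣ r n c c - t n c c ∣ ≢ m
|r-t|≢m-family n c n≢m |r-t|≡m = n≢m (trans (sym (|r-t|-family n c)) |r-t|≡m)

Triple : Set
Triple = ℕ × ℕ × ℕ

box : ℕ → List Triple
box n = cartesianProduct (upTo (2 * n + 2)) (cartesianProduct (upTo (2 * n + 2)) (upTo (4 * n + 2)))

∈-box : ∀ {n a b c} → a ≤ b → Bounded n b c → (a , b , c) ∈ box n
∈-box a≤b (b<2n+2 , c<4n+2) = ∈-cartesianProduct⁺ (∈-upTo⁺ (≤-trans (s≤s a≤b) b<2n+2))
  (∈-cartesianProduct⁺ (∈-upTo⁺ b<2n+2) (∈-upTo⁺ c<4n+2))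

nn≡⇒family⊎∈box : ∀ {n a b c} → Admissible a b c → nn a b c ≡ + n → Family n a b c ⊎ (a , b , c) ∈ box n
nn≡⇒family⊎∈box {n} {a} {b} {c} adm@(_ , a≤b , _) nn≡n =
  Sum.map₂ (∈-box {n} a≤b) (family⊎bounded adm (Equivalence.to (nn≡+⇔ a b c n) nn≡n))

Admissible? : ∀ a b c → Dec (Admissible a b c)
Admissible? a b c = 1 ≤? a ×-dec a ≤? b ×-dec 1 ≤? c ×-dec gcd (gcd a b) c ≟ 1

Admissible⇒ : (C T : ℕ → ℕ → ℕ → Set) → Triple → Set
Admissible⇒ C T (a , b , c) = Admissible a b c → C a b c → T a b c

admissible⇒? : ∀ {C T : ℕ → ℕ → ℕ → Set} → (∀ a b c → Dec (C a b c)) → (∀ a b c → Dec (T a b c)) →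
               ∀ x → Dec (Admissible⇒ C T x)
admissible⇒? C? T? (a , b , c) = Admissible? a b c →-dec C? a b c →-dec T? a b c

-- The search hypothesis is left as _ at each use and discharged by evaluating the decision procedure.
classify : ∀ n {C T : ℕ → ℕ → ℕ → Set} (C? : ∀ a b c → Dec (C a b c)) (T? : ∀ a b c → Dec (T a b c)) →
           (∀ {a b c} → C a b c → nn a b c ≡ + n) →
           (∀ {c} → n < c → gcd n c ≡ 1 → C n c c → T n c c) →
           True (All.all? (admissible⇒? C? T?) (box n)) →
           ∀ {a b c} → Admissible a b c → C a b c → T a b c
classify n C? T? C⇒nn≡n family-case box-checked adm C[a,b,c] with nn≡⇒family⊎∈box adm (C⇒nn≡n C[a,b,c])
... | inj₁ (refl , refl , n<c , gcd[n,c]≡1) = family-case n<c gcd[n,c]≡1 C[a,b,c]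
... | inj₂ ∈box = All.lookup (toWitness box-checked) ∈box adm C[a,b,c]

open import Data.Integer.Divisibility using (_∣_)
import Data.Nat.Divisibility as ℕ

infix 4 _∣?_ _≟₃_

_∣?_ : ∀ i j → Dec (i ∣ j)
i ∣? j = ∣ i ∣ ℕ.∣? ∣ j ∣

_≟₃_ : (x y : Triple) → Dec (x ≡ y)
_≟₃_ = ≡-dec _≟_ (≡-dec _≟_ _≟_)

Solutions₂ : ℕ → ℕ → ℕ → Set
Solutions₂ a b c = (a , b , c) ≡ (1 , 1 , 2) ⊎ (a ≡ 1 × b ≡ c)

solutions₂? : ∀ a b c → Dec (Solutions₂ a b c)
solutions₂? a b c = (a , b , c) ≟₃ (1 , 1 , 2) ⊎-dec (a ≟ 1 ×-dec b ≟ c)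

classification₂ : ∀ a b c → Admissible a b c → (nn a b c ≡ + 1 ⇔ Solutions₂ a b c)
classification₂ a b c adm =
  mk⇔ (classify 1 (λ a b c → nn a b c ℤ.≟ + 1) solutions₂? id (λ _ _ _ → inj₂ (refl , refl)) _ adm)
      solution⇒nn≡1
  where
  solution⇒nn≡1 : ∀ {a b c} → Solutions₂ a b c → nn a b c ≡ + 1
  solution⇒nn≡1 (inj₁ refl) = refl
  solution⇒nn≡1 {c = c} (inj₂ (refl , refl)) = nn-family 1 c (gcd-zeroˡ c)

Condition₃ Solutions₃ : ℕ → ℕ → ℕ → Set
Condition₃ a b c = + 2 ∣ δ a b c × nn a b c ≡ + 2
Solutions₃ a b c = (a , b , c) ≡ (1 , 2 , 1) ⊎ (a , b , c) ≡ (1 , 2 , 3)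
                   ⊎ (a ≡ 2 × b ≡ c × 2 < c × c % 2 ≡ 1)

condition₃? : ∀ a b c → Dec (Condition₃ a b c)
condition₃? a b c = + 2 ∣? δ a b c ×-dec nn a b c ℤ.≟ + 2

solutions₃? : ∀ a b c → Dec (Solutions₃ a b c)
solutions₃? a b c = (a , b , c) ≟₃ (1 , 2 , 1) ⊎-dec (a , b , c) ≟₃ (1 , 2 , 3)
                    ⊎-dec (a ≟ 2 ×-dec b ≟ c ×-dec 2 <? c ×-dec c % 2 ≟ 1)

classification₃ : ∀ a b c → Admissible a b c → (Condition₃ a b c ⇔ Solutions₃ a b c)
classification₃ a b c adm =
  mk⇔ (classify 2 condition₃? solutions₃? proj₂ family _ adm) (solution⇒condition adm)
  where
  family : ∀ {c} → 2 < c → gcd 2 c ≡ 1 → Condition₃ 2 c c → Solutions₃ 2 c c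
  family {c} 2<c gcd[2,c]≡1 _ = inj₂ (inj₂ (refl , refl , 2<c , gcd[2k,n]≡1⇒n%2≡1 1 c gcd[2,c]≡1))
  solution⇒condition : ∀ {a b c} → Admissible a b c → Solutions₃ a b c → Condition₃ a b c
  solution⇒condition _ (inj₁ refl) = from-yes (condition₃? 1 2 1)
  solution⇒condition _ (inj₂ (inj₁ refl)) = from-yes (condition₃? 1 2 3)
  solution⇒condition {c = c} adm (inj₂ (inj₂ (refl , refl , _))) =
    subst (+ 2 ∣_) (sym (δ-family 2 c)) (from-yes (+ 2 ∣? + 2)) , nn-family 2 c (coprime-if-b≡c adm)

Condition₄ Solutions₄ : ℕ → ℕ → ℕ → Set
Condition₄ a b c = ∣ r a b c - t a b c ∣ ≢ 0 × + 2 ∣ δ a b c × nn a b c ≡ + 4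
Solutions₄ a b c = (a , b , c) ≡ (1 , 2 , 5) ⊎ (a , b , c) ≡ (1 , 4 , 1)
                   ⊎ (a , b , c) ≡ (1 , 4 , 3) ⊎ (a , b , c) ≡ (1 , 6 , 3)
                   ⊎ (a , b , c) ≡ (2 , 3 , 1) ⊎ (a , b , c) ≡ (3 , 4 , 3)
                   ⊎ (a ≡ 4 × b ≡ c × 4 < c × c % 2 ≡ 1)

condition₄? : ∀ a b c → Dec (Condition₄ a b c)
condition₄? a b c = ¬? (∣ r a b c - t a b c ∣ ≟ 0) ×-dec + 2 ∣? δ a b c ×-dec nn a b c ℤ.≟ + 4

solutions₄? : ∀ a b c → Dec (Solutions₄ a b c)
solutions₄? a b c = (a , b , c) ≟₃ (1 , 2 , 5) ⊎-dec (a , b , c) ≟₃ (1 , 4 , 1)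
                    ⊎-dec (a , b , c) ≟₃ (1 , 4 , 3) ⊎-dec (a , b , c) ≟₃ (1 , 6 , 3)
                    ⊎-dec (a , b , c) ≟₃ (2 , 3 , 1) ⊎-dec (a , b , c) ≟₃ (3 , 4 , 3)
                    ⊎-dec (a ≟ 4 ×-dec b ≟ c ×-dec 4 <? c ×-dec c % 2 ≟ 1)

classification₄ : ∀ a b c → Admissible a b c → (Condition₄ a b c ⇔ Solutions₄ a b c)
classification₄ a b c adm =
  mk⇔ (classify 4 condition₄? solutions₄? (proj₂ ∘ proj₂) family _ adm) (solution⇒condition adm)
  where
  family : ∀ {c} → 4 < c → gcd 4 c ≡ 1 → Condition₄ 4 c c → Solutions₄ 4 c c
  family {c} 4<c gcd[4,c]≡1 _ =
    inj₂ (inj₂ (inj₂ (inj₂ (inj₂ (inj₂ (refl , refl , 4<c , gcd[2k,n]≡1⇒n%2≡1 2 c gcd[4,c]≡1))))))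
  solution⇒condition : ∀ {a b c} → Admissible a b c → Solutions₄ a b c → Condition₄ a b c
  solution⇒condition _ (inj₁ refl) = from-yes (condition₄? 1 2 5)
  solution⇒condition _ (inj₂ (inj₁ refl)) = from-yes (condition₄? 1 4 1)
  solution⇒condition _ (inj₂ (inj₂ (inj₁ refl))) = from-yes (condition₄? 1 4 3)
  solution⇒condition _ (inj₂ (inj₂ (inj₂ (inj₁ refl)))) = from-yes (condition₄? 1 6 3)
  solution⇒condition _ (inj₂ (inj₂ (inj₂ (inj₂ (inj₁ refl))))) = from-yes (condition₄? 2 3 1)
  solution⇒condition _ (inj₂ (inj₂ (inj₂ (inj₂ (inj₂ (inj₁ refl)))))) = from-yes (condition₄? 3 4 3)
  solution⇒condition {c = c} adm (inj₂ (inj₂ (inj₂ (inj₂ (inj₂ (inj₂ (refl , refl , _))))))) =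
    |r-t|≢m-family 4 c (λ ()) ,
    subst (+ 2 ∣_) (sym (δ-family 4 c)) (from-yes (+ 2 ∣? + 4)) ,
    nn-family 4 c (coprime-if-b≡c adm)

Condition₅ Solutions₅ Condition₆ Solutions₆ : ℕ → ℕ → ℕ → Set
Condition₅ a b c = ∣ r a b c - t a b c ∣ ≡ 6 × nn a b c ≡ + 8
Solutions₅ a b c = (a , b , c) ≡ (1 , 2 , 9) ⊎ (a , b , c) ≡ (1 , 8 , 3)
                   ⊎ (a , b , c) ≡ (2 , 7 , 3) ⊎ (a , b , c) ≡ (4 , 5 , 3)
Condition₆ a b c = ∣ r a b c - t a b c ∣ ≡ 6 × nn a b c ≡ + 9
Solutions₆ a b c = (a , b , c) ≡ (1 , 3 , 10) ⊎ (a , b , c) ≡ (1 , 9 , 4)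
                   ⊎ (a , b , c) ≡ (3 , 7 , 4) ⊎ (a , b , c) ≡ (5 , 5 , 4)

condition₅? : ∀ a b c → Dec (Condition₅ a b c)
condition₅? a b c = ∣ r a b c - t a b c ∣ ≟ 6 ×-dec nn a b c ℤ.≟ + 8

solutions₅? : ∀ a b c → Dec (Solutions₅ a b c)
solutions₅? a b c = (a , b , c) ≟₃ (1 , 2 , 9) ⊎-dec (a , b , c) ≟₃ (1 , 8 , 3)
                    ⊎-dec (a , b , c) ≟₃ (2 , 7 , 3) ⊎-dec (a , b , c) ≟₃ (4 , 5 , 3)

condition₆? : ∀ a b c → Dec (Condition₆ a b c)
condition₆? a b c = ∣ r a b c - t a b c ∣ ≟ 6 ×-dec nn a b c ℤ.≟ + 9

solutions₆? : ∀ a b c → Dec (Solutions₆ a b c)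
solutions₆? a b c = (a , b , c) ≟₃ (1 , 3 , 10) ⊎-dec (a , b , c) ≟₃ (1 , 9 , 4)
                    ⊎-dec (a , b , c) ≟₃ (3 , 7 , 4) ⊎-dec (a , b , c) ≟₃ (5 , 5 , 4)

classification₅ : ∀ a b c → Admissible a b c → (Condition₅ a b c ⇔ Solutions₅ a b c)
classification₅ a b c adm = mk⇔ (classify 8 condition₅? solutions₅? proj₂ family _ adm) solution⇒condition
  where
  family : ∀ {c} → 8 < c → gcd 8 c ≡ 1 → Condition₅ 8 c c → Solutions₅ 8 c c
  family {c} _ _ (|r-t|≡6 , _) = contradiction |r-t|≡6 (|r-t|≢m-family 8 c λ ())
  solution⇒condition : ∀ {a b c} → Solutions₅ a b c → Condition₅ a b c
  solution⇒condition (inj₁ refl) = refl , refl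
  solution⇒condition (inj₂ (inj₁ refl)) = refl , refl
  solution⇒condition (inj₂ (inj₂ (inj₁ refl))) = refl , refl
  solution⇒condition (inj₂ (inj₂ (inj₂ refl))) = refl , refl

classification₆ : ∀ a b c → Admissible a b c → (Condition₆ a b c ⇔ Solutions₆ a b c)
classification₆ a b c adm = mk⇔ (classify 9 condition₆? solutions₆? proj₂ family _ adm) solution⇒condition
  where
  family : ∀ {c} → 9 < c → gcd 9 c ≡ 1 → Condition₆ 9 c c → Solutions₆ 9 c c
  family {c} _ _ (|r-t|≡6 , _) = contradiction |r-t|≡6 (|r-t|≢m-family 9 c λ ())
  solution⇒condition : ∀ {a b c} → Solutions₆ a b c → Condition₆ a b c
  solution⇒condition (inj₁ refl) = refl , refl
  solution⇒condition (inj₂ (inj₁ refl)) = refl , refl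
  solution⇒condition (inj₂ (inj₂ (inj₁ refl))) = refl , refl
  solution⇒condition (inj₂ (inj₂ (inj₂ refl))) = refl , refl

nn≡n₀-classification : ∀ n₀ → ∃[ L ] (∀ a b c → Admissible a b c →
                       (nn a b c ≡ + n₀ ⇔ ((a , b , c) ∈ L ⊎ Family n₀ a b c)))
nn≡n₀-classification n₀ =
  filter nn≡n₀? (box n₀) , λ a b c adm → mk⇔ (nn≡n₀⇒listed⊎family adm) listed⊎family⇒nn≡n₀
  where
  nn₃ : Triple → ℤ
  nn₃ (a , b , c) = nn a b c
  nn≡n₀? : ∀ x → Dec (nn₃ x ≡ + n₀)
  nn≡n₀? x = nn₃ x ℤ.≟ + n₀
  nn≡n₀⇒listed⊎family : ∀ {a b c} → Admissible a b c → nn a b c ≡ + n₀ →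
                        (a , b , c) ∈ filter nn≡n₀? (box n₀) ⊎ Family n₀ a b c
  nn≡n₀⇒listed⊎family adm nn≡n₀ with nn≡⇒family⊎∈box adm nn≡n₀
  ... | inj₁ family = inj₂ family
  ... | inj₂ ∈box = inj₁ (∈-filter⁺ nn≡n₀? ∈box nn≡n₀)
  listed⊎family⇒nn≡n₀ : ∀ {a b c} → (a , b , c) ∈ filter nn≡n₀? (box n₀) ⊎ Family n₀ a b c →
                        nn a b c ≡ + n₀
  listed⊎family⇒nn≡n₀ (inj₁ ∈filter) = proj₂ (∈-filter⁻ nn≡n₀? {xs = box n₀} ∈filter)
  listed⊎family⇒nn≡n₀ {c = c} (inj₂ (refl , refl , _ , gcd[n₀,c]≡1)) = nn-family n₀ c gcd[n₀,c]≡1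

lemma3p9 :
  -- (1)
  (∀ a b c → Admissible a b c → a + b ≡ c →
      gcd a b ≡ 1 × gcd a c ≡ 1 × gcd b c ≡ 1
      × nn a b c ≡ + c - + 1 × nn a b c ≡ + (a + b) - + 1)
  -- (2)
  × (∀ a b c → Admissible a b c → Data.Integer._≤_ (+ 1) (nn a b c))
  × (∀ a b c → Admissible a b c →
      (nn a b c ≡ + 1 ⇔ ((a , b , c) ≡ (1 , 1 , 2) ⊎ (a ≡ 1 × b ≡ c))))
  -- (3)
  × (∀ a b c → Admissible a b c →
      ((+ 2 ∣ δ a b c × nn a b c ≡ + 2) ⇔
        ((a , b , c) ≡ (1 , 2 , 1) ⊎ (a , b , c) ≡ (1 , 2 , 3)
         ⊎ (a ≡ 2 × b ≡ c × 2 < c × c % 2 ≡ 1))))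
  -- (4)
  × (∀ a b c → Admissible a b c →
      ((∣ r a b c - t a b c ∣ ≢ 0 × + 2 ∣ δ a b c × nn a b c ≡ + 4) ⇔
        ((a , b , c) ≡ (1 , 2 , 5) ⊎ (a , b , c) ≡ (1 , 4 , 1)
         ⊎ (a , b , c) ≡ (1 , 4 , 3) ⊎ (a , b , c) ≡ (1 , 6 , 3)
         ⊎ (a , b , c) ≡ (2 , 3 , 1) ⊎ (a , b , c) ≡ (3 , 4 , 3)
         ⊎ (a ≡ 4 × b ≡ c × 4 < c × c % 2 ≡ 1))))
  -- (5)
  × (∀ a b c → Admissible a b c →
      ((∣ r a b c - t a b c ∣ ≡ 6 × nn a b c ≡ + 8) ⇔
        ((a , b , c) ≡ (1 , 2 , 9) ⊎ (a , b , c) ≡ (1 , 8 , 3)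
         ⊎ (a , b , c) ≡ (2 , 7 , 3) ⊎ (a , b , c) ≡ (4 , 5 , 3))))
  -- (6)
  × (∀ a b c → Admissible a b c →
      ((∣ r a b c - t a b c ∣ ≡ 6 × nn a b c ≡ + 9) ⇔
        ((a , b , c) ≡ (1 , 3 , 10) ⊎ (a , b , c) ≡ (1 , 9 , 4)
         ⊎ (a , b , c) ≡ (3 , 7 , 4) ⊎ (a , b , c) ≡ (5 , 5 , 4))))
  -- (7)
  × (∀ n₀ → 1 ≤ n₀ → ∃[ L ] (∀ a b c → Admissible a b c →
      (nn a b c ≡ + n₀ ⇔
        ((a , b , c) ∈ L ⊎ (a ≡ n₀ × b ≡ c × n₀ < c × gcd n₀ c ≡ 1)))))
  -- the identities |r - t| = |a + b - c| used in (4)-(6)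
  × (∀ a b c → ∣ r a b c - t a b c ∣ ≡ ∣ δ a b c ∣)
lemma3p9 =
  (λ a b c adm a+b≡c →
    let gcd[a,b]≡1 , gcd[a,c]≡1 , gcd[b,c]≡1 = pairwise-coprime-if-a+b≡c adm a+b≡c
        nn≡c-1 = a+b≡c⇒nn≡c-1 adm a+b≡c
    in gcd[a,b]≡1 , gcd[a,c]≡1 , gcd[b,c]≡1 , nn≡c-1 ,
       subst (λ m → nn a b c ≡ + m - + 1) (sym a+b≡c) nn≡c-1) ,
  (λ _ _ _ → 1≤nn) ,
  classification₂ , classification₃ , classification₄ , classification₅ , classification₆ ,
  (λ n₀ _ → nn≡n₀-classification n₀) ,
  (λ a b c → cong ∣_∣ (r-t≡δ a b c))
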